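{- For every integer $m \geq 3$, $\gamma^{\mathrm{GID}}(K_m^3) = m^2$.
   Context: $K_m^3$ is the Hamming graph with vertex set $\mathbb{Z}_m^3$, a group under componentwise addition modulo $m$, two vertices adjacent iff they differ in exactly one coordinate. For $C \subseteq \mathbb{Z}_m^3$, $J_C(v) = N[v] \cap C$ with $N[v]$ the closed neighborhood. $C$ is an identifying code if the sets $J_C(v)$ are all nonempty and pairwise distinct; a group identifying code is an identifying code that is a subgroup. $\gamma^{\mathrm{GID}}$ is the minimum cardinality of a group identifying code. -}

module Defs where

open import Data.Nat using (ℕ; zero; suc; _+_; _∸_; _≤_; NonZero)
open import Data.Nat.DivMod using (_mod_)
open import Data.Fin using (Fin; toℕ)
open import Data.Fin.Properties using (_≟_)
open import Data.Bool using () renaming (_≟_ to _≟B_)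
open import Data.Bool using (Bool; true; false; _∧_; not; if_then_else_)
open import Data.Sum using (_⊎_)
open import Data.Product using (_×_; _,_; ∃)
open import Data.List using (List; length; filter; concatMap; map; allFin)
open import Relation.Nullary using (¬_)
open import Relation.Nullary.Decidable using (⌊_⌋)
open import Relation.Binary.PropositionalEquality using (_≡_)

-- Vertices of K_m^3 : elements of Z_m^3, with Z_m represented by Fin m.
Vertex : ℕ → Set
Vertex m = Fin m × Fin m × Fin m

module _ (m : ℕ) .{{_ : NonZero m}} where
  zeroₘ : Fin m
  zeroₘ = 0 mod m

  addₘ : Fin m → Fin m → Fin m
  addₘ a b = (toℕ a + toℕ b) mod m

  negₘ : Fin m → Fin m
  negₘ a = (m ∸ toℕ a) mod m

  0V : Vertex m
  0V = zeroₘ , zeroₘ , zeroₘ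

  _⊕_ : Vertex m → Vertex m → Vertex m
  (a₁ , a₂ , a₃) ⊕ (b₁ , b₂ , b₃) = addₘ a₁ b₁ , addₘ a₂ b₂ , addₘ a₃ b₃

  ⊖_ : Vertex m → Vertex m
  ⊖ (a₁ , a₂ , a₃) = negₘ a₁ , negₘ a₂ , negₘ a₃

Subset3 : ℕ → Set
Subset3 m = Vertex m → Bool

diffB : ∀ {m} → Fin m → Fin m → ℕ
diffB a b = if ⌊ a ≟ b ⌋ then 0 else 1

dist : ∀ {m} → Vertex m → Vertex m → ℕ
dist (a₁ , a₂ , a₃) (b₁ , b₂ , b₃) = diffB a₁ b₁ + diffB a₂ b₂ + diffB a₃ b₃

Adj : ∀ {m} → Vertex m → Vertex m → Set
Adj u v = dist u v ≡ 1

InN : ∀ {m} → Vertex m → Vertex m → Set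
InN v w = (w ≡ v) ⊎ Adj v w

InJ : ∀ {m} → Subset3 m → Vertex m → Vertex m → Set
InJ C v w = InN v w × C w ≡ true

IsIdentifyingCode : (m : ℕ) → Subset3 m → Set
IsIdentifyingCode m C =
  (∀ v → ∃ λ w → InJ C v w) ×
  (∀ u v → ¬ (u ≡ v) → ¬ (∀ w → (InJ C u w → InJ C v w) × (InJ C v w → InJ C u w)))

IsSubgroup : (m : ℕ) .{{_ : NonZero m}} → Subset3 m → Set
IsSubgroup m C =
  (C (0V m) ≡ true) ×
  (∀ u v → C u ≡ true → C v ≡ true → C (_⊕_ m u v) ≡ true) ×
  (∀ u → C u ≡ true → C (⊖_ m u) ≡ true)

IsGroupIdentifyingCode : (m : ℕ) .{{_ : NonZero m}} → Subset3 m → Set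
IsGroupIdentifyingCode m C = IsSubgroup m C × IsIdentifyingCode m C

allVertices : (m : ℕ) → List (Vertex m)
allVertices m =
  concatMap (λ a → concatMap (λ b → map (λ c → a , b , c) (allFin m)) (allFin m)) (allFin m)

card : ∀ {m} → Subset3 m → ℕ
card {m} C = length (filter (λ v → C v ≟B true) (allVertices m))

GammaGIDIs : (m : ℕ) .{{_ : NonZero m}} → ℕ → Set
GammaGIDIs m k =
  (∃ λ C → IsGroupIdentifyingCode m C × card C ≡ k) ×
  (∀ C → IsGroupIdentifyingCode m C → k ≤ card C)

-- Upper bound: C₀ = {(a , b , c) | a + b + c = 0} is the kernel of a homomorphism onto ℤₘ, so
-- it is a subgroup with m² elements, and every line of K_m³ meets it exactly once.  Hence
-- J(v) = {v} for v ∈ C₀, while for v ∉ C₀ the set J(v) consists of the three points where the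
-- lines through v meet C₀, and v is the only common closed neighbour of these three points.
--
-- Lower bound: if for some direction every line meets the subgroup C, then |C| ≥ m².  Otherwise,
-- for every direction d the points whose d-line meets C form a proper subgroup, and as no group
-- is the union of two proper subgroups, for each direction i some point x has both its lines in
-- the other directions disjoint from C.  Then J(x) lies on the i-line through x, which forces C
-- to meet the i-th axis only in 0: a nonzero codeword t eᵢ would give J(x) = J(x + t eᵢ).  Once
-- every axis meets C only in 0, each codeword w has J(w) = {w}, whereas J(x) = {w} for the only
-- codeword w on the i-line through x; so C does not separate x from w.

module Submission where

open import Defs
open import Data.Nat using (ℕ; _≤_; _^_; NonZero)
open import Algebra.Bundles using (AbelianGroup)
open import Algebra.Structures using (IsAbelianGroup)
open import Algebra.Definitions using (Associative; Commutative; LeftIdentity; RightInverse)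
import Algebra.Properties.AbelianGroup
import Algebra.Properties.CommutativeSemigroup
open import Algebra.Consequences.Propositional using (comm∧idˡ⇒id; comm∧invʳ⇒inv)
open import Data.Nat using (zero; suc; _+_; _*_; _∸_; _%_; z≤n)
open import Data.Nat.Properties
  using (+-comm; +-assoc; m∸n+n≡m; <⇒≤; +-mono-≤; ≤-trans; m≤m+n; ≤-reflexive; +-0-commutativeMonoid; module ≤-Reasoning)
open import Data.Nat.DivMod using (_mod_; %-distribˡ-+; m%n%n≡m%n; m<n⇒m%n≡m; [m+n]%n≡m%n)
open import Data.Fin using (Fin; toℕ; zero; suc)
open import Data.Fin.Properties
  using (_≟_; any?; all?; ¬∀⟶∃¬; toℕ-fromℕ<; toℕ-injective; toℕ<n; punchInᵢ≢i)
open import Data.Vec.Functional using (removeAt)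
open import Data.Product using (_×_; _,_; ∃; proj₁; proj₂; swap)
open import Data.Fin.Patterns using (0F; 1F; 2F)
open import Function using (_∘_; id)
open import Data.Bool using (Bool; true; false; if_then_else_) renaming (_≟_ to _≟B_)
open import Data.List using (List; _++_; length; filter; concatMap; map; tabulate; allFin)
open import Data.List.Properties using (filter-++; length-++; map-tabulate)
open import Level using (0ℓ)
open import Relation.Binary.PropositionalEquality
  using (_≡_; _≢_; refl; sym; trans; cong; cong₂; subst; isEquivalence; module ≡-Reasoning)
open import Relation.Nullary using (¬_; Dec; yes; no; ⌊_⌋)
open import Relation.Nullary.Decidable using (dec-true; dec-false; isYes≗does)
open import Data.Sum using (_⊎_; inj₁; inj₂)
open import Data.Empty using (⊥-elim)
open import Relation.Unary using (Pred; Decidable)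
open import Relation.Binary using (_Respects_)

module _ {A : Set} {_∙_ : A → A → A} {ε : A} {_⁻¹ : A → A} where

  isAbelianGroup-≡ : Associative _≡_ _∙_ → Commutative _≡_ _∙_ →
                     LeftIdentity _≡_ ε _∙_ → RightInverse _≡_ ε _⁻¹ _∙_ →
                     IsAbelianGroup _≡_ _∙_ ε _⁻¹
  isAbelianGroup-≡ assoc comm identityˡ inverseʳ = record
    { isGroup = record
      { isMonoid = record
        { isSemigroup = record
          { isMagma = record { isEquivalence = isEquivalence ; ∙-cong = cong₂ _∙_ }
          ; assoc = assoc }
        ; identity = comm∧idˡ⇒id comm identityˡ }
      ; inverse = comm∧invʳ⇒inv comm inverseʳ
      ; ⁻¹-cong = cong _⁻¹ }
    ; comm = comm }

module _ {c ℓ} (G : AbelianGroup c ℓ) where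
  open AbelianGroup G renaming (trans to ≈-trans)
  open import Algebra.Properties.AbelianGroup G using (//-rightDividesʳ; ⁻¹-∙-comm)
  open import Algebra.Properties.CommutativeSemigroup commutativeSemigroup using (interchange)
  open import Relation.Binary.Reasoning.Setoid setoid

  [x∙y]-[z∙w]≈[x-z]∙[y-w] : ∀ x y z w → (x ∙ y) - (z ∙ w) ≈ (x - z) ∙ (y - w)
  [x∙y]-[z∙w]≈[x-z]∙[y-w] x y z w = begin
    (x ∙ y) ∙ (z ∙ w) ⁻¹        ≈⟨ ∙-congˡ (⁻¹-∙-comm z w) ⟨
    (x ∙ y) ∙ (z ⁻¹ ∙ w ⁻¹)     ≈⟨ interchange x y (z ⁻¹) (w ⁻¹) ⟩
    (x ∙ z ⁻¹) ∙ (y ∙ w ⁻¹)     ∎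

  outside-two-subgroups :
    ∀ {p q} {P : Pred Carrier p} {Q : Pred Carrier q} → Decidable P → Decidable Q →
    P Respects _≈_ → Q Respects _≈_ →
    (∀ {x y} → P x → P y → P (x - y)) → (∀ {x y} → Q x → Q y → Q (x - y)) →
    ∃ (¬_ ∘ P) → ∃ (¬_ ∘ Q) → ∃ λ x → ¬ P x × ¬ Q x
  outside-two-subgroups P? Q? P-resp Q-resp P-sub Q-sub (p , p∉P) (q , q∉Q) with Q? p | P? q
  ... | no p∉Q  | _       = p , p∉P , p∉Q
  ... | yes _   | no q∉P  = q , q∉P , q∉Q
  ... | yes p∈Q | yes q∈P =
    p ∙ q
    , (λ pq∈P → p∉P (P-resp (//-rightDividesʳ q p) (P-sub pq∈P q∈P)))
    , (λ pq∈Q → q∉Q (Q-resp (≈-trans (∙-congʳ (comm p q)) (//-rightDividesʳ p q)) (Q-sub pq∈Q p∈Q)))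

open import Algebra.Properties.CommutativeMonoid.Sum +-0-commutativeMonoid
  using (sum; sum-syntax; sum-cong-≗; sum-remove; sum-replicate-zero; ∑-comm)

∑-const : ∀ n k → ∑[ i < n ] k ≡ n * k
∑-const zero    k = refl
∑-const (suc n) k = cong (k +_) (∑-const n k)

∑-mono-≤ : ∀ {n} {f g : Fin n → ℕ} → (∀ i → f i ≤ g i) → sum f ≤ sum g
∑-mono-≤ {zero}  f≤g = z≤n
∑-mono-≤ {suc n} f≤g = +-mono-≤ (f≤g zero) (∑-mono-≤ (f≤g ∘ suc))

≤-∑ : ∀ {n} (f : Fin n → ℕ) i → f i ≤ sum f
≤-∑ {suc n} f i = ≤-trans (m≤m+n (f i) _) (≤-reflexive (sym (sum-remove {i = i} f)))

∑-delta : ∀ {n} (f : Fin n → ℕ) i → f i ≡ 1 → (∀ j → j ≢ i → f j ≡ 0) → sum f ≡ 1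
∑-delta {suc n} f i fi≡1 f≡0 = begin
  sum f                    ≡⟨ sum-remove {i = i} f ⟩
  f i + sum (removeAt f i) ≡⟨ cong₂ _+_ fi≡1 (sum-cong-≗ (λ j → f≡0 _ (punchInᵢ≢i i j))) ⟩
  1 + ∑[ _ < n ] 0          ≡⟨ cong (1 +_) (sum-replicate-zero n) ⟩
  1                        ∎
  where open ≡-Reasoning

indicator : Bool → ℕ
indicator true  = 1
indicator false = 0

module _ {A : Set} (P : A → Bool) where

  count : List A → ℕ
  count xs = length (filter (λ x → P x ≟B true) xs)

  count-tabulate : ∀ {n} (f : Fin n → A) → count (tabulate f) ≡ ∑[ i < n ] indicator (P (f i))
  count-tabulate {zero}  f = refl
  count-tabulate {suc n} f with P (f zero)
  ... | true  = cong suc (count-tabulate (f ∘ suc))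
  ... | false = count-tabulate (f ∘ suc)

  count-concatMap-tabulate : ∀ {B : Set} {n} (g : B → List A) (f : Fin n → B) →
                             count (concatMap g (tabulate f)) ≡ ∑[ i < n ] count (g (f i))
  count-concatMap-tabulate {n = zero}  g f = refl
  count-concatMap-tabulate {n = suc n} g f = begin
    length (filter _ (g (f zero) ++ concatMap g (tabulate (f ∘ suc))))
      ≡⟨ cong length (filter-++ _ (g (f zero)) _) ⟩
    length (filter _ (g (f zero)) ++ filter _ (concatMap g (tabulate (f ∘ suc))))
      ≡⟨ length-++ (filter _ (g (f zero))) ⟩
    count (g (f zero)) + count (concatMap g (tabulate (f ∘ suc)))
      ≡⟨ cong (count (g (f zero)) +_) (count-concatMap-tabulate g (f ∘ suc)) ⟩
    count (g (f zero)) + ∑[ i < n ] count (g (f (suc i)))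
      ∎
    where open ≡-Reasoning

module _ (m : ℕ) .{{_ : NonZero m}} where

  private
    toℕ-mod : ∀ n → toℕ (n mod m) ≡ n % m
    toℕ-mod n = toℕ-fromℕ< _

    [x%m+y]%m≡[x+y]%m : ∀ x y → (x % m + y) % m ≡ (x + y) % m
    [x%m+y]%m≡[x+y]%m x y = begin
      (x % m + y) % m           ≡⟨ %-distribˡ-+ (x % m) y m ⟩
      (x % m % m + y % m) % m   ≡⟨ cong (λ t → (t + y % m) % m) (m%n%n≡m%n x m) ⟩
      (x % m + y % m) % m       ≡⟨ %-distribˡ-+ x y m ⟨
      (x + y) % m               ∎
      where open ≡-Reasoning

    [x+y%m]%m≡[x+y]%m : ∀ x y → (x + y % m) % m ≡ (x + y) % m
    [x+y%m]%m≡[x+y]%m x y = begin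
      (x + y % m) % m ≡⟨ cong (_% m) (+-comm x (y % m)) ⟩
      (y % m + x) % m ≡⟨ [x%m+y]%m≡[x+y]%m y x ⟩
      (y + x) % m     ≡⟨ cong (_% m) (+-comm y x) ⟩
      (x + y) % m     ∎
      where open ≡-Reasoning

  addₘ-assoc : Associative _≡_ (addₘ m)
  addₘ-assoc a b c = toℕ-injective (begin
    toℕ (addₘ m (addₘ m a b) c)                 ≡⟨ toℕ-mod _ ⟩
    (toℕ (addₘ m a b) + toℕ c) % m              ≡⟨ cong (λ t → (t + toℕ c) % m) (toℕ-mod _) ⟩
    ((toℕ a + toℕ b) % m + toℕ c) % m           ≡⟨ [x%m+y]%m≡[x+y]%m _ _ ⟩
    (toℕ a + toℕ b + toℕ c) % m                 ≡⟨ cong (_% m) (+-assoc (toℕ a) _ _) ⟩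
    (toℕ a + (toℕ b + toℕ c)) % m               ≡⟨ [x+y%m]%m≡[x+y]%m _ _ ⟨
    (toℕ a + (toℕ b + toℕ c) % m) % m           ≡⟨ cong (λ t → (toℕ a + t) % m) (toℕ-mod _) ⟨
    (toℕ a + toℕ (addₘ m b c)) % m              ≡⟨ toℕ-mod _ ⟨
    toℕ (addₘ m a (addₘ m b c))                 ∎)
    where open ≡-Reasoning

  addₘ-comm : Commutative _≡_ (addₘ m)
  addₘ-comm a b = cong (_mod m) (+-comm (toℕ a) (toℕ b))

  addₘ-identityˡ : LeftIdentity _≡_ (zeroₘ m) (addₘ m)
  addₘ-identityˡ a = toℕ-injective (begin
    toℕ (addₘ m (zeroₘ m) a)       ≡⟨ toℕ-mod _ ⟩
    (toℕ (zeroₘ m) + toℕ a) % m    ≡⟨ cong (λ t → (t + toℕ a) % m) (toℕ-mod 0) ⟩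
    (0 % m + toℕ a) % m            ≡⟨ [x%m+y]%m≡[x+y]%m 0 (toℕ a) ⟩
    toℕ a % m                      ≡⟨ m<n⇒m%n≡m (toℕ<n a) ⟩
    toℕ a                          ∎)
    where open ≡-Reasoning

  negₘ-inverseʳ : RightInverse _≡_ (zeroₘ m) (negₘ m) (addₘ m)
  negₘ-inverseʳ a = toℕ-injective (begin
    toℕ (addₘ m a (negₘ m a))          ≡⟨ toℕ-mod _ ⟩
    (toℕ a + toℕ (negₘ m a)) % m       ≡⟨ cong (λ t → (toℕ a + t) % m) (toℕ-mod _) ⟩
    (toℕ a + (m ∸ toℕ a) % m) % m      ≡⟨ [x+y%m]%m≡[x+y]%m (toℕ a) _ ⟩
    (toℕ a + (m ∸ toℕ a)) % m          ≡⟨ cong (_% m) (+-comm (toℕ a) _) ⟩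
    (m ∸ toℕ a + toℕ a) % m            ≡⟨ cong (_% m) (m∸n+n≡m (<⇒≤ (toℕ<n a))) ⟩
    m % m                              ≡⟨ [m+n]%n≡m%n 0 m ⟩
    0 % m                              ≡⟨ toℕ-mod 0 ⟨
    toℕ (zeroₘ m)                      ∎)
    where open ≡-Reasoning

  ℤₘ : AbelianGroup 0ℓ 0ℓ
  ℤₘ = record { isAbelianGroup = isAbelianGroup-≡ addₘ-assoc addₘ-comm addₘ-identityˡ negₘ-inverseʳ }

  private
    module ℤ = AbelianGroup ℤₘ
    module ℤP = Algebra.Properties.AbelianGroup ℤₘ
    module ℤS = Algebra.Properties.CommutativeSemigroup (AbelianGroup.commutativeSemigroup ℤₘ)

    ×₃-≡ : ∀ {a b c a′ b′ c′ : Fin m} → a ≡ a′ → b ≡ b′ → c ≡ c′ →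
           _≡_ {A = Vertex m} (a , b , c) (a′ , b′ , c′)
    ×₃-≡ p q r = cong₂ _,_ p (cong₂ _,_ q r)

  ℤₘ³ : AbelianGroup 0ℓ 0ℓ
  ℤₘ³ = record { isAbelianGroup = isAbelianGroup-≡ {_∙_ = _⊕_ m} assoc comm identityˡ inverseʳ }
    where
    assoc : Associative _≡_ (_⊕_ m)
    assoc _ _ _ = ×₃-≡ (ℤ.assoc _ _ _) (ℤ.assoc _ _ _) (ℤ.assoc _ _ _)
    comm : Commutative _≡_ (_⊕_ m)
    comm (a₁ , a₂ , a₃) (b₁ , b₂ , b₃) = ×₃-≡ (ℤ.comm a₁ b₁) (ℤ.comm a₂ b₂) (ℤ.comm a₃ b₃)
    identityˡ : LeftIdentity _≡_ (0V m) (_⊕_ m)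
    identityˡ _ = ×₃-≡ (ℤ.identityˡ _) (ℤ.identityˡ _) (ℤ.identityˡ _)
    inverseʳ : RightInverse _≡_ (0V m) (⊖_ m) (_⊕_ m)
    inverseʳ _ = ×₃-≡ (ℤ.inverseʳ _) (ℤ.inverseʳ _) (ℤ.inverseʳ _)

  private
    module V = AbelianGroup ℤₘ³
    module VP = Algebra.Properties.AbelianGroup ℤₘ³

  open AbelianGroup ℤₘ using () renaming (_∙_ to _+ᶻ_; _-_ to _-ᶻ_; ε to 0ᶻ; _⁻¹ to -ᶻ_)
  open AbelianGroup ℤₘ³ using () renaming (_∙_ to _+ᵛ_; _-_ to _-ᵛ_; ε to 0ᵛ)

  -- Lines and closed neighbourhoods in K_m³

  axis : Fin 3 → Fin m → Vertex m
  axis 0F t = t  , 0ᶻ , 0ᶻ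
  axis 1F t = 0ᶻ , t  , 0ᶻ
  axis 2F t = 0ᶻ , 0ᶻ , t

  axis-0 : ∀ d → axis d 0ᶻ ≡ 0ᵛ
  axis-0 0F = refl
  axis-0 1F = refl
  axis-0 2F = refl

  axis-injective : ∀ d {s t} → axis d s ≡ axis d t → s ≡ t
  axis-injective 0F eq = cong proj₁ eq
  axis-injective 1F eq = cong (proj₁ ∘ proj₂) eq
  axis-injective 2F eq = cong (proj₂ ∘ proj₂) eq


  axis-homo-+ : ∀ d s t → axis d (s +ᶻ t) ≡ axis d s +ᵛ axis d t
  axis-homo-+ 0F s t = ×₃-≡ refl (sym (ℤ.identityˡ 0ᶻ)) (sym (ℤ.identityˡ 0ᶻ))
  axis-homo-+ 1F s t = ×₃-≡ (sym (ℤ.identityˡ 0ᶻ)) refl (sym (ℤ.identityˡ 0ᶻ))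
  axis-homo-+ 2F s t = ×₃-≡ (sym (ℤ.identityˡ 0ᶻ)) (sym (ℤ.identityˡ 0ᶻ)) refl

  axis-homo-⁻¹ : ∀ d t → axis d (-ᶻ t) ≡ V._⁻¹ (axis d t)
  axis-homo-⁻¹ 0F t = ×₃-≡ refl (sym ℤP.ε⁻¹≈ε) (sym ℤP.ε⁻¹≈ε)
  axis-homo-⁻¹ 1F t = ×₃-≡ (sym ℤP.ε⁻¹≈ε) refl (sym ℤP.ε⁻¹≈ε)
  axis-homo-⁻¹ 2F t = ×₃-≡ (sym ℤP.ε⁻¹≈ε) (sym ℤP.ε⁻¹≈ε) refl

  axis-homo‿- : ∀ d s t → axis d (s -ᶻ t) ≡ axis d s -ᵛ axis d t
  axis-homo‿- d s t = trans (axis-homo-+ d s (-ᶻ t)) (cong (axis d s +ᵛ_) (axis-homo-⁻¹ d t))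

  +-axis-0 : ∀ d x → x +ᵛ axis d 0ᶻ ≡ x
  +-axis-0 d x = trans (cong (x +ᵛ_) (axis-0 d)) (V.identityʳ x)

  data OnLine (d : Fin 3) (x : Vertex m) : Vertex m → Set where
    move : ∀ t → OnLine d x (x +ᵛ axis d t)

  OnLine-resp : ∀ {d x w w′} → w ≡ w′ → OnLine d x w → OnLine d x w′
  OnLine-resp {d} {x} = subst (OnLine d x)

  OnLine-refl : ∀ d x → OnLine d x x
  OnLine-refl d x = OnLine-resp (+-axis-0 d x) (move 0ᶻ)

  OnLine-sym : ∀ {d x w} → OnLine d x w → OnLine d w x
  OnLine-sym {d} {x} (move t) = OnLine-resp (begin
    (x +ᵛ axis d t) +ᵛ axis d (-ᶻ t)   ≡⟨ cong ((x +ᵛ axis d t) +ᵛ_) (axis-homo-⁻¹ d t) ⟩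
    (x +ᵛ axis d t) -ᵛ axis d t        ≡⟨ VP.//-rightDividesʳ (axis d t) x ⟩
    x                                  ∎) (move (-ᶻ t))
    where open ≡-Reasoning

  OnLine-trans : ∀ {d x y z} → OnLine d x y → OnLine d y z → OnLine d x z
  OnLine-trans {d} {x} (move s) (move t) = OnLine-resp (begin
    x +ᵛ axis d (s +ᶻ t)          ≡⟨ cong (x +ᵛ_) (axis-homo-+ d s t) ⟩
    x +ᵛ (axis d s +ᵛ axis d t)   ≡⟨ V.assoc x _ _ ⟨
    (x +ᵛ axis d s) +ᵛ axis d t   ∎) (move (s +ᶻ t))
    where open ≡-Reasoning

  private
    diffB-≡ : ∀ {a b : Fin m} → a ≡ b → diffB a b ≡ 0
    diffB-≡ {a} {b} a≡b = cong (λ β → if β then 0 else 1) (trans (isYes≗does _) (dec-true (a ≟ b) a≡b))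

    diffB-≢ : ∀ {a b : Fin m} → a ≢ b → diffB a b ≡ 1
    diffB-≢ {a} {b} a≢b = cong (λ β → if β then 0 else 1) (trans (isYes≗does _) (dec-false (a ≟ b) a≢b))

    +₃-cong : ∀ {p q r p′ q′ r′} → p ≡ p′ → q ≡ q′ → r ≡ r′ → p + q + r ≡ p′ + q′ + r′
    +₃-cong p q r = cong₂ _+_ (cong₂ _+_ p q) r

    fixed : ∀ a → a ≡ a +ᶻ 0ᶻ
    fixed a = sym (ℤ.identityʳ a)

    moved : ∀ a {t} → t ≢ 0ᶻ → a ≢ a +ᶻ t
    moved a t≢0 eq = t≢0 (ℤP.identityʳ-unique a _ (sym eq))

    same : ∀ {a b} → a ≡ b → b -ᶻ a ≡ 0ᶻ
    same a≡b = ℤP.x≈y⇒x∙y⁻¹≈ε (sym a≡b)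

    offset : ∀ {x w} d t → w -ᵛ x ≡ axis d t → OnLine d x w
    offset {x} {w} d t eq = OnLine-resp (begin
      x +ᵛ axis d t        ≡⟨ cong (x +ᵛ_) eq ⟨
      x +ᵛ (w -ᵛ x)        ≡⟨ cong (x +ᵛ_) (V.comm w _) ⟩
      x +ᵛ (V._⁻¹ x +ᵛ w)  ≡⟨ VP.\\-leftDividesˡ x w ⟩
      w                    ∎) (move t)
      where open ≡-Reasoning

  dist-axis : ∀ d x {t} → t ≢ 0ᶻ → dist x (x +ᵛ axis d t) ≡ 1
  dist-axis 0F (a , b , c) t≢0 = +₃-cong (diffB-≢ (moved a t≢0)) (diffB-≡ (fixed b)) (diffB-≡ (fixed c))
  dist-axis 1F (a , b , c) t≢0 = +₃-cong (diffB-≡ (fixed a)) (diffB-≢ (moved b t≢0)) (diffB-≡ (fixed c))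
  dist-axis 2F (a , b , c) t≢0 = +₃-cong (diffB-≡ (fixed a)) (diffB-≡ (fixed b)) (diffB-≢ (moved c t≢0))

  OnLine⇒InN : ∀ {d x w} → OnLine d x w → InN x w
  OnLine⇒InN {d} {x} (move t) with t ≟ 0ᶻ
  ... | yes refl = inj₁ (+-axis-0 d x)
  ... | no t≢0   = inj₂ (dist-axis d x t≢0)

  InN⇒OnLine : ∀ {x w} → InN x w → ∃ λ d → OnLine d x w
  InN⇒OnLine {x} (inj₁ refl) = 0F , OnLine-refl 0F x
  InN⇒OnLine {a₁ , a₂ , a₃} {b₁ , b₂ , b₃} (inj₂ adj) with a₁ ≟ b₁ | a₂ ≟ b₂ | a₃ ≟ b₃
  ... | no _  | yes q | yes r = 0F , offset 0F (b₁ -ᶻ a₁) (×₃-≡ refl (same q) (same r))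
  ... | yes p | no _  | yes r = 1F , offset 1F (b₂ -ᶻ a₂) (×₃-≡ (same p) refl (same r))
  ... | yes p | yes q | no _  = 2F , offset 2F (b₃ -ᶻ a₃) (×₃-≡ (same p) (same q) refl)
  ... | yes _ | yes _ | yes _ with () ← adj
  ... | no _  | no _  | _     with () ← adj
  ... | no _  | yes _ | no _  with () ← adj
  ... | yes _ | no _  | no _  with () ← adj

  coord : Fin 3 → Vertex m → Fin m
  coord 0F = proj₁
  coord 1F = proj₁ ∘ proj₂
  coord 2F = proj₂ ∘ proj₂

  coord-line-≡ : ∀ k x t → coord k (x +ᵛ axis k t) ≡ coord k x +ᶻ t
  coord-line-≡ 0F x t = refl
  coord-line-≡ 1F x t = refl
  coord-line-≡ 2F x t = refl

  coord-line-≢ : ∀ {d k} x t → d ≢ k → coord k (x +ᵛ axis d t) ≡ coord k x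
  coord-line-≢ {0F} {0F} _ _ d≢k = ⊥-elim (d≢k refl)
  coord-line-≢ {1F} {1F} _ _ d≢k = ⊥-elim (d≢k refl)
  coord-line-≢ {2F} {2F} _ _ d≢k = ⊥-elim (d≢k refl)
  coord-line-≢ {0F} {1F} _ _ _ = ℤ.identityʳ _
  coord-line-≢ {0F} {2F} _ _ _ = ℤ.identityʳ _
  coord-line-≢ {1F} {0F} _ _ _ = ℤ.identityʳ _
  coord-line-≢ {1F} {2F} _ _ _ = ℤ.identityʳ _
  coord-line-≢ {2F} {0F} _ _ _ = ℤ.identityʳ _
  coord-line-≢ {2F} {1F} _ _ _ = ℤ.identityʳ _

  InN⇒agree : ∀ {v w k l} → InN v w → k ≢ l → coord k v ≡ coord k w ⊎ coord l v ≡ coord l w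
  InN⇒agree {v} {k = k} {l} v~w k≢l with InN⇒OnLine v~w
  ... | d , move t with d ≟ k
  ...   | yes refl = inj₂ (sym (coord-line-≢ v t k≢l))
  ...   | no d≢k   = inj₁ (sym (coord-line-≢ v t d≢k))

  common-neighbour-unique : ∀ {u v r} → r ≢ 0ᶻ → (∀ d → InN v (u +ᵛ axis d r)) → v ≡ u
  common-neighbour-unique {u} {v} {r} r≢0 v~u+r = ×₃-≡
      (coord-fixed 0F 1F 2F (λ ()) (λ ()) (λ ()))
      (coord-fixed 1F 0F 2F (λ ()) (λ ()) (λ ()))
      (coord-fixed 2F 0F 1F (λ ()) (λ ()) (λ ()))
    where
    coord-fixed : ∀ k d e → d ≢ k → e ≢ k → e ≢ d → coord k v ≡ coord k u
    coord-fixed k d e d≢k e≢k e≢d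
      with InN⇒agree (v~u+r d) (d≢k ∘ sym) | InN⇒agree (v~u+r e) (d≢k ∘ sym)
    ... | inj₁ p | _      = trans p (coord-line-≢ u r d≢k)
    ... | inj₂ _ | inj₁ q = trans q (coord-line-≢ u r e≢k)
    ... | inj₂ p | inj₂ q = ⊥-elim (r≢0 (ℤP.identityʳ-unique (coord d u) r (begin
      coord d u +ᶻ r            ≡⟨ coord-line-≡ d u r ⟨
      coord d (u +ᵛ axis d r)   ≡⟨ trans (sym p) q ⟩
      coord d (u +ᵛ axis e r)   ≡⟨ coord-line-≢ u r e≢d ⟩
      coord d u                 ∎)))
      where open ≡-Reasoning

  SameJ : Subset3 m → Vertex m → Vertex m → Set
  SameJ C u v = ∀ w → (InJ C u w → InJ C v w) × (InJ C v w → InJ C u w)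

  along : Fin 3 → Fin m → Fin m → Fin m → Vertex m
  along 0F a b t = t , a , b
  along 1F a b t = a , t , b
  along 2F a b t = a , b , t

  along-line : ∀ d a b t → along d a b 0ᶻ +ᵛ axis d t ≡ along d a b t
  along-line 0F a b t = ×₃-≡ (ℤ.identityˡ t) (ℤ.identityʳ a) (ℤ.identityʳ b)
  along-line 1F a b t = ×₃-≡ (ℤ.identityʳ a) (ℤ.identityˡ t) (ℤ.identityʳ b)
  along-line 2F a b t = ×₃-≡ (ℤ.identityʳ a) (ℤ.identityʳ b) (ℤ.identityˡ t)

  card-∑ : ∀ C → card C ≡ ∑[ a < m ] ∑[ b < m ] ∑[ c < m ] indicator (C (a , b , c))
  card-∑ C =
    trans (count-concatMap-tabulate C plane id) (sum-cong-≗ {m} λ a →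
    trans (count-concatMap-tabulate C (row a) id) (sum-cong-≗ {m} λ b →
    trans (cong (count C) (map-tabulate id (λ c → a , b , c))) (count-tabulate C (λ c → a , b , c))))
    where
    row : Fin m → Fin m → List (Vertex m)
    row a b = map (λ c → a , b , c) (allFin m)
    plane : Fin m → List (Vertex m)
    plane a = concatMap (row a) (allFin m)

  card-along : ∀ C d → card C ≡ ∑[ a < m ] ∑[ b < m ] ∑[ t < m ] indicator (C (along d a b t))
  card-along C 0F = trans (card-∑ C) (trans (∑-comm {m} {m} _) (sum-cong-≗ {m} λ _ → ∑-comm {m} {m} _))
  card-along C 1F = trans (card-∑ C) (sum-cong-≗ {m} λ _ → ∑-comm {m} {m} _)
  card-along C 2F = card-∑ C

  ∑∑1≡m² : ∑[ a < m ] ∑[ b < m ] 1 ≡ m ^ 2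
  ∑∑1≡m² = trans (sum-cong-≗ {m} λ _ → ∑-const m 1) (∑-const m (m * 1))

  covered⇒m²≤card : ∀ C d → (∀ a b → ∃ λ t → C (along d a b t) ≡ true) → m ^ 2 ≤ card C
  covered⇒m²≤card C d covered = begin
    m ^ 2                                                         ≡⟨ ∑∑1≡m² ⟨
    ∑[ a < m ] ∑[ b < m ] 1                                       ≤⟨ ∑-mono-≤ (λ a → ∑-mono-≤ (line-hit a)) ⟩
    ∑[ a < m ] ∑[ b < m ] ∑[ t < m ] indicator (C (along d a b t)) ≡⟨ card-along C d ⟨
    card C                                                        ∎
    where
    open ≤-Reasoning
    line-hit : ∀ a b → 1 ≤ ∑[ t < m ] indicator (C (along d a b t))
    line-hit a b with covered a b
    ... | t , hit = ≤-trans (≤-reflexive (cong indicator (sym hit))) (≤-∑ _ t)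

  -- The code a + b + c = 0

  σ : Vertex m → Fin m
  σ (a , b , c) = a +ᶻ b +ᶻ c

  σ-homo : ∀ u v → σ (u +ᵛ v) ≡ σ u +ᶻ σ v
  σ-homo (a₁ , a₂ , a₃) (b₁ , b₂ , b₃) =
    trans (cong (_+ᶻ (a₃ +ᶻ b₃)) (ℤS.interchange a₁ b₁ a₂ b₂))
          (ℤS.interchange (a₁ +ᶻ a₂) (b₁ +ᶻ b₂) a₃ b₃)

  σ-0 : σ 0ᵛ ≡ 0ᶻ
  σ-0 = trans (ℤ.identityʳ _) (ℤ.identityʳ _)

  σ-⁻¹ : ∀ u → σ (V._⁻¹ u) ≡ -ᶻ σ u
  σ-⁻¹ u = ℤP.inverseʳ-unique (σ u) _ (trans (sym (σ-homo u _)) (trans (cong σ (V.inverseʳ u)) σ-0))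

  σ-axis : ∀ d t → σ (axis d t) ≡ t
  σ-axis 0F t = trans (ℤ.identityʳ _) (ℤ.identityʳ t)
  σ-axis 1F t = trans (ℤ.identityʳ _) (ℤ.identityˡ t)
  σ-axis 2F t = trans (cong (_+ᶻ t) (ℤ.identityˡ 0ᶻ)) (ℤ.identityˡ t)

  σ-line : ∀ d x t → σ (x +ᵛ axis d t) ≡ σ x +ᶻ t
  σ-line d x t = trans (σ-homo x (axis d t)) (cong (σ x +ᶻ_) (σ-axis d t))

  C₀ : Subset3 m
  C₀ v = ⌊ σ v ≟ 0ᶻ ⌋

  ∈C₀ : ∀ v → σ v ≡ 0ᶻ → C₀ v ≡ true
  ∈C₀ v σv≡0 = trans (isYes≗does (σ v ≟ 0ᶻ)) (dec-true (σ v ≟ 0ᶻ) σv≡0)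

  ∈C₀⁻¹ : ∀ v → C₀ v ≡ true → σ v ≡ 0ᶻ
  ∈C₀⁻¹ v v∈C₀ with σ v ≟ 0ᶻ
  ... | yes σv≡0 = σv≡0
  ... | no _ with () ← v∈C₀

  C₀-isSubgroup : IsSubgroup m C₀
  C₀-isSubgroup =
      ∈C₀ 0ᵛ σ-0
    , (λ u v u∈ v∈ → ∈C₀ (u +ᵛ v) (begin
        σ (u +ᵛ v)      ≡⟨ σ-homo u v ⟩
        σ u +ᶻ σ v      ≡⟨ cong₂ _+ᶻ_ (∈C₀⁻¹ u u∈) (∈C₀⁻¹ v v∈) ⟩
        0ᶻ +ᶻ 0ᶻ        ≡⟨ ℤ.identityˡ 0ᶻ ⟩
        0ᶻ              ∎))
    , (λ u u∈ → ∈C₀ (V._⁻¹ u) (trans (σ-⁻¹ u) (trans (cong -ᶻ_ (∈C₀⁻¹ u u∈)) ℤP.ε⁻¹≈ε)))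
    where open ≡-Reasoning

  C₀-on-line : ∀ v d → InJ C₀ v (v +ᵛ axis d (-ᶻ σ v))
  C₀-on-line v d =
      OnLine⇒InN (move {d} {v} (-ᶻ σ v))
    , ∈C₀ (v +ᵛ axis d (-ᶻ σ v)) (trans (σ-line d v _) (ℤ.inverseʳ (σ v)))

  J-C₀-codeword : ∀ {x w} → σ x ≡ 0ᶻ → InJ C₀ x w → w ≡ x
  J-C₀-codeword {x} σx≡0 (x~w , w∈) with InN⇒OnLine x~w
  ... | d , move t = trans (cong (λ s → x +ᵛ axis d s) t≡0) (+-axis-0 d x)
    where
    t≡0 : t ≡ 0ᶻ
    t≡0 = begin
      t              ≡⟨ ℤ.identityˡ t ⟨
      0ᶻ +ᶻ t        ≡⟨ cong (_+ᶻ t) σx≡0 ⟨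
      σ x +ᶻ t       ≡⟨ σ-line d x t ⟨
      σ (x +ᵛ axis d t) ≡⟨ ∈C₀⁻¹ (x +ᵛ axis d t) w∈ ⟩
      0ᶻ             ∎
      where open ≡-Reasoning

  ∉C₀ : ∀ v → σ v ≢ 0ᶻ → C₀ v ≡ false
  ∉C₀ v σv≢0 = trans (isYes≗does (σ v ≟ 0ᶻ)) (dec-false (σ v ≟ 0ᶻ) σv≢0)

  card-C₀ : card C₀ ≡ m ^ 2
  card-C₀ = trans (card-∑ C₀) (trans (sum-cong-≗ {m} λ a → sum-cong-≗ {m} (one-solution a)) ∑∑1≡m²)
    where
    one-solution : ∀ a b → ∑[ c < m ] indicator (C₀ (a , b , c)) ≡ 1
    one-solution a b = ∑-delta _ (-ᶻ (a +ᶻ b))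
      (cong indicator (∈C₀ (a , b , -ᶻ (a +ᶻ b)) (ℤ.inverseʳ (a +ᶻ b))))
      (λ c c≢ → cong indicator (∉C₀ (a , b , c) (c≢ ∘ ℤP.inverseʳ-unique (a +ᶻ b) c)))

  C₀-isIdentifyingCode : IsIdentifyingCode m C₀
  C₀-isIdentifyingCode = (λ v → _ , C₀-on-line v 0F) , separates
    where
    -≢0 : ∀ {s} → s ≢ 0ᶻ → -ᶻ s ≢ 0ᶻ
    -≢0 s≢0 eq = s≢0 (ℤP.⁻¹-injective (trans eq (sym ℤP.ε⁻¹≈ε)))

    codeword≉noncodeword : ∀ {u v} → σ u ≡ 0ᶻ → σ v ≢ 0ᶻ → ¬ SameJ C₀ u v
    codeword≉noncodeword {u} {v} σu≡0 σv≢0 same =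
      -≢0 σv≢0 (cong proj₁ (VP.∙-cancelˡ v _ _ (trans (on-u 0F) (sym (on-u 1F)))))
      where
      on-u : ∀ d → v +ᵛ axis d (-ᶻ σ v) ≡ u
      on-u d = J-C₀-codeword σu≡0 (proj₂ (same _) (C₀-on-line v d))

    separates : ∀ u v → u ≢ v → ¬ SameJ C₀ u v
    separates u v u≢v same with σ u ≟ 0ᶻ | σ v ≟ 0ᶻ
    ... | yes σu≡0 | yes σv≡0 = u≢v (J-C₀-codeword σv≡0 (proj₁ (same u) (inj₁ refl , ∈C₀ u σu≡0)))
    ... | yes σu≡0 | no σv≢0  = codeword≉noncodeword σu≡0 σv≢0 same
    ... | no σu≢0  | yes σv≡0 = codeword≉noncodeword σv≡0 σu≢0 (swap ∘ same)
    ... | no σu≢0  | no _     =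
      u≢v (sym (common-neighbour-unique (-≢0 σu≢0) (λ d → proj₁ (proj₁ (same _) (C₀-on-line u d)))))

  -- Lower bound for group identifying codes

  module LowerBound (C : Subset3 m) (C-subgroup : IsSubgroup m C) (C-code : IsIdentifyingCode m C) where

    infix 4 _∈C
    _∈C : Vertex m → Set
    x ∈C = C x ≡ true

    -‿closed : ∀ {x y} → x ∈C → y ∈C → x -ᵛ y ∈C
    -‿closed {x} {y} x∈ y∈ = let (_ , ⊕-closed , ⊖-closed) = C-subgroup in ⊕-closed x _ x∈ (⊖-closed y y∈)

    Meets : Fin 3 → Vertex m → Set
    Meets d x = ∃ λ t → x +ᵛ axis d t ∈C

    Meets? : ∀ d → Decidable (Meets d)
    Meets? d x = any? λ t → C (x +ᵛ axis d t) ≟B true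

    ∈C⇒Meets : ∀ d {x} → x ∈C → Meets d x
    ∈C⇒Meets d {x} x∈ = 0ᶻ , subst _∈C (sym (+-axis-0 d x)) x∈

    OnLine⇒Meets : ∀ {d x w} → OnLine d x w → w ∈C → Meets d x
    OnLine⇒Meets (move t) w∈ = t , w∈

    Meets-closed : ∀ {d x y} → Meets d x → Meets d y → Meets d (x -ᵛ y)
    Meets-closed {d} {x} {y} (s , xs∈) (t , yt∈) = s -ᶻ t , subst _∈C line-difference (-‿closed xs∈ yt∈)
      where
      line-difference : (x +ᵛ axis d s) -ᵛ (y +ᵛ axis d t) ≡ (x -ᵛ y) +ᵛ axis d (s -ᶻ t)
      line-difference = trans ([x∙y]-[z∙w]≈[x-z]∙[y-w] ℤₘ³ x _ y _)
                              (cong ((x -ᵛ y) +ᵛ_) (sym (axis-homo‿- d s t)))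

    Meets-translate : ∀ {d x h} → h ∈C → Meets d (x +ᵛ h) → Meets d x
    Meets-translate {d} {x} {h} h∈ meets =
      subst (Meets d) (VP.//-rightDividesʳ h x) (Meets-closed {d} {x +ᵛ h} meets (∈C⇒Meets d h∈))

    OthersMiss : Fin 3 → Vertex m → Set
    OthersMiss i x = ∀ d → d ≢ i → ¬ Meets d x

    OthersMiss-translate : ∀ {i x h} → h ∈C → OthersMiss i x → OthersMiss i (x +ᵛ h)
    OthersMiss-translate h∈ others d d≢i = others d d≢i ∘ Meets-translate {d} h∈

    J⊆line : ∀ {i x w} → OthersMiss i x → InJ C x w → OnLine i x w
    J⊆line {i} others (x~w , w∈) with InN⇒OnLine x~w
    ... | d , on with d ≟ i
    ...   | yes refl = on
    ...   | no d≢i   = ⊥-elim (others d d≢i (OnLine⇒Meets on w∈))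

    SameJ-line : ∀ {i x y} → OthersMiss i x → OthersMiss i y → OnLine i x y → SameJ C x y
    SameJ-line ox oy x-y w =
        (λ w∈Jx → OnLine⇒InN (OnLine-trans (OnLine-sym x-y) (J⊆line ox w∈Jx)) , proj₂ w∈Jx)
      , (λ w∈Jy → OnLine⇒InN (OnLine-trans x-y (J⊆line oy w∈Jy)) , proj₂ w∈Jy)

    AxisTrivial : Fin 3 → Set
    AxisTrivial i = ∀ t → axis i t ∈C → t ≡ 0ᶻ

    OthersMiss⇒AxisTrivial : ∀ {i x} → OthersMiss i x → AxisTrivial i
    OthersMiss⇒AxisTrivial {i} {x} others t t∈ with t ≟ 0ᶻ
    ... | yes t≡0 = t≡0
    ... | no t≢0  = ⊥-elim (proj₂ C-code x (x +ᵛ axis i t) x≢x+t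
                      (SameJ-line others (OthersMiss-translate t∈ others) (move t)))
      where
      x≢x+t : x ≢ x +ᵛ axis i t
      x≢x+t eq = t≢0 (axis-injective i (trans (VP.identityʳ-unique x _ (sym eq)) (sym (axis-0 i))))

    line-meets-once : ∀ {i w v} → AxisTrivial i → OnLine i w v → w ∈C → v ∈C → v ≡ w
    line-meets-once {i} {w} trivial (move t) w∈ v∈ = trans (cong (λ s → w +ᵛ axis i s) t≡0) (+-axis-0 i w)
      where
      t≡0 : t ≡ 0ᶻ
      t≡0 = trivial t (subst _∈C (VP.xyx⁻¹≈y w (axis i t)) (-‿closed v∈ w∈))

    J-codeword : ∀ {w v} → (∀ d → AxisTrivial d) → w ∈C → InJ C w v → v ≡ w
    J-codeword trivial w∈ (w~v , v∈) with InN⇒OnLine w~v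
    ... | d , on = line-meets-once (trivial d) on w∈ v∈

    OthersMiss-∉C-impossible : ∀ {i x} → OthersMiss i x → ¬ x ∈C → ¬ (∀ d → AxisTrivial d)
    OthersMiss-∉C-impossible {i} {x} others x∉ trivial with proj₁ C-code x
    ... | w , w∈Jx@(_ , w∈) = proj₂ C-code x w x≢w λ v →
        (λ v∈Jx → subst (InJ C w) (sym (J-noncodeword v∈Jx)) (inj₁ refl , w∈))
      , (λ v∈Jw → subst (InJ C x) (sym (J-codeword trivial w∈ v∈Jw)) w∈Jx)
      where
      x≢w : x ≢ w
      x≢w refl = x∉ w∈
      J-noncodeword : ∀ {v} → InJ C x v → v ≡ w
      J-noncodeword v∈Jx@(_ , v∈) =
        line-meets-once (trivial i) (OnLine-trans (OnLine-sym (J⊆line others w∈Jx)) (J⊆line others v∈Jx)) w∈ v∈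

    Covers : Fin 3 → Set
    Covers d = ∀ a b → ∃ λ t → along d a b t ∈C

    covers? : ∀ d → Dec (Covers d)
    covers? d = all? λ a → all? λ b → any? λ t → C (along d a b t) ≟B true

    ¬Covers⇒uncovered : ∀ {d} → ¬ Covers d → ∃ λ x → ¬ Meets d x
    ¬Covers⇒uncovered {d} ¬covers
      with a , ¬a ← ¬∀⟶∃¬ m _ (λ a → all? λ b → any? λ t → C (along d a b t) ≟B true) ¬covers
      with b , ¬b ← ¬∀⟶∃¬ m _ (λ b → any? λ t → C (along d a b t) ≟B true) ¬a
      = along d a b 0ᶻ , λ (t , hit) → ¬b (t , subst _∈C (along-line d a b t) hit)

    uncovered-impossible : ¬ (∀ d → ∃ λ x → ¬ Meets d x)
    uncovered-impossible uncovered =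
      OthersMiss-∉C-impossible (proj₂ (others 0F)) (proj₂ (others 0F) 1F (λ ()) ∘ ∈C⇒Meets 1F)
        (λ d → OthersMiss⇒AxisTrivial (proj₂ (others d)))
      where
      avoid : ∀ j k → ∃ λ x → ¬ Meets j x × ¬ Meets k x
      avoid j k = outside-two-subgroups ℤₘ³ (Meets? j) (Meets? k) (subst (Meets j)) (subst (Meets k))
                    (Meets-closed {j}) (Meets-closed {k}) (uncovered j) (uncovered k)
      others : ∀ i → ∃ (OthersMiss i)
      others 0F with x , ¬1 , ¬2 ← avoid 1F 2F =
        x , λ { 0F 0≢0 → ⊥-elim (0≢0 refl) ; 1F _ → ¬1 ; 2F _ → ¬2 }
      others 1F with x , ¬0 , ¬2 ← avoid 0F 2F =
        x , λ { 0F _ → ¬0 ; 1F 1≢1 → ⊥-elim (1≢1 refl) ; 2F _ → ¬2 }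
      others 2F with x , ¬0 , ¬1 ← avoid 0F 1F =
        x , λ { 0F _ → ¬0 ; 1F _ → ¬1 ; 2F 2≢2 → ⊥-elim (2≢2 refl) }

    m²≤card : m ^ 2 ≤ card C
    m²≤card with any? covers?
    ... | yes (d , covers) = covered⇒m²≤card C d covers
    ... | no ¬covers       = ⊥-elim (uncovered-impossible λ d → ¬Covers⇒uncovered (¬covers ∘ (d ,_)))

-- The argument works for every m ≥ 1.
mainTheorem10 : (m : ℕ) .{{_ : NonZero m}} → 3 ≤ m → GammaGIDIs m (m ^ 2)
mainTheorem10 m _ =
    (C₀ m , (C₀-isSubgroup m , C₀-isIdentifyingCode m) , card-C₀ m)
  , λ C (C-subgroup , C-code) → LowerBound.m²≤card m C C-subgroup C-code
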